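{- Let $p,q$ be positive integers with $2\le p/q<4$, let $G$ be a connected graph with a fixed orientation, and let $f,g$ be two $(p,q)$-colourings of $G$. Let $T$ be a spanning tree of $G$ rooted at a vertex $u$ and let $X=\{v\in V(G):\operatorname{wt}(v,\varphi_f)\le\operatorname{wt}(v,\varphi_g)\}$. If both $D_f[X]$ and $D_f[V(G)\setminus X]$ contain a directed cycle, then $f$ does not reconfigure to $g$.
   Context: A $(p,q)$-colouring of $G$ is a map $f:V(G)\to\{0,\dots,p-1\}$ with $q\le|f(u)-f(v)|\le p-q$ for every edge $uv$; $f$ reconfigures to $g$ if there is a sequence $f=f_0,\dots,f_n=g$ of $(p,q)$-colourings with consecutive ones differing on only one vertex. The induced edge-labelling is $\varphi_f(e)=f(y)-f(x)\bmod p$ for $e$ oriented from $x$ to $y$. For a path $P$ with a direction of traversal, $\varphi_f(P)=\sum_{e\text{ forward}}\varphi_f(e)+\sum_{e\text{ backward}}(p-\varphi_f(e))$ (sum in $\mathbb{Z}$; forward edges are those oriented along the traversal). For $v\in V(G)$, $\operatorname{wt}(v,\varphi_f)=\varphi_f(P)$ where $P$ is the $(u,v)$-path in $T$ traversed from $u$ to $v$. $D_f$ is the digraph on $V(G)$ with an arc from $x$ to $y$ whenever $xy\in E(G)$ and $f(y)-f(x)\equiv q\pmod p$. -}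

module Defs where

open import Data.Nat using (ℕ; zero; suc; _+_; _*_; _∸_; _≤_; _<_; NonZero; ∣_-_∣)
open import Data.Nat.DivMod using (_%_)
open import Data.Fin using (Fin; toℕ; _≟_)
open import Data.Product using (Σ; _×_; _,_)
open import Data.Sum using (_⊎_; inj₁; inj₂)
open import Data.Empty using (⊥)
open import Data.List using (List; []; _∷_; length)
open import Data.List.Membership.Propositional using (_∈_)
open import Data.List.Relation.Unary.All using (All)
open import Data.List.Relation.Unary.Unique.Propositional using (Unique)
open import Relation.Nullary using (¬_; yes; no)
open import Relation.Binary.PropositionalEquality using (_≡_; _≢_)
open import Relation.Binary.Construct.Closure.ReflexiveTransitive using (Star)

-- An oriented (simple) graph on vertex set Fin n: a list of arcs (x , y),
-- i.e. each edge xy of G together with its fixed orientation x → y.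
Edges : ℕ → Set
Edges n = List (Fin n × Fin n)

IsOriented : {n : ℕ} → Edges n → Set
IsOriented E = ∀ x y → (x , y) ∈ E → ¬ ((y , x) ∈ E)

Adj : {n : ℕ} → Edges n → Fin n → Fin n → Set
Adj E x y = (x , y) ∈ E ⊎ (y , x) ∈ E

IsPQColouring : {n : ℕ} (p q : ℕ) → Edges n → (Fin n → Fin p) → Set
IsPQColouring p q E f =
  ∀ x y → (x , y) ∈ E →
    (q ≤ ∣ toℕ (f x) - toℕ (f y) ∣) × (∣ toℕ (f x) - toℕ (f y) ∣ ≤ p ∸ q)

PQColouring : {n : ℕ} (p q : ℕ) → Edges n → Set
PQColouring p q E = Σ (Fin _ → Fin p) (IsPQColouring p q E)

Step : {n p q : ℕ} {E : Edges n} → PQColouring p q E → PQColouring p q E → Set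
Step {n} (f , _) (g , _) = Σ (Fin n) λ v → ∀ w → w ≢ v → f w ≡ g w

Reconfigures : {n p q : ℕ} {E : Edges n} → PQColouring p q E → PQColouring p q E → Set
Reconfigures = Star Step

-- (f(y) - f(x)) mod p, for colour values in {0,…,p-1}.
diffMod : (p : ℕ) .{{_ : NonZero p}} → Fin p → Fin p → ℕ
diffMod p a b = (toℕ b + (p ∸ toℕ a)) % p

φ : {n : ℕ} (p : ℕ) .{{_ : NonZero p}} → (Fin n → Fin p) → Fin n → Fin n → ℕ
φ p f x y = diffMod p (f x) (f y)

-- A spanning tree T of G rooted at `root`, given by parent pointers:
-- every non-root vertex v has a parent joined to it by an edge of G
-- (the tree edge, with its orientation in G recorded by the ⊎-tag), and
-- depths strictly decrease towards the root (so T is acyclic and spanning).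
record RootedSpanningTree {n : ℕ} (E : Edges n) : Set where
  field
    root        : Fin n
    parent      : Fin n → Fin n
    depth       : Fin n → ℕ
    parent-edge : ∀ v → v ≢ root → (parent v , v) ∈ E ⊎ (v , parent v) ∈ E
    depth-dec   : ∀ v → v ≢ root → depth (parent v) < depth v

module _ {n : ℕ} {E : Edges n} (T : RootedSpanningTree E)
         (p : ℕ) .{{_ : NonZero p}} (f : Fin n → Fin p) where
  open RootedSpanningTree T

  contrib : ∀ v → (parent v , v) ∈ E ⊎ (v , parent v) ∈ E → ℕ
  contrib v (inj₁ _) = φ p f (parent v) v
  contrib v (inj₂ _) = p ∸ φ p f v (parent v)

  wtFuel : ℕ → Fin n → ℕ
  wtFuel zero    v = 0
  wtFuel (suc k) v with v ≟ root
  ... | yes _  = 0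
  ... | no ne  = wtFuel k (parent v) + contrib v (parent-edge v ne)

  -- wt(v, φ_f) = φ_f(P), P the (root,v)-path in T traversed from root to v.
  wt : Fin n → ℕ
  wt v = wtFuel (suc (depth v)) v

DArc : {n : ℕ} (p q : ℕ) .{{_ : NonZero p}} → Edges n → (Fin n → Fin p) → Fin n → Fin n → Set
DArc p q E f x y = Adj E x y × (diffMod p (f x) (f y) ≡ q % p)

-- Directed cycle in a digraph (relation A) on vertices: a list of distinct
-- vertices v₀ … v_{k-1}, k ≥ 2, with arcs vᵢ → vᵢ₊₁ and v_{k-1} → v₀.
ArcsFrom : {V : Set} → (V → V → Set) → V → V → List V → Set
ArcsFrom A h x []       = A x h
ArcsFrom A h x (y ∷ ys) = A x y × ArcsFrom A h y ys

CycleArcs : {V : Set} → (V → V → Set) → List V → Set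
CycleArcs A []       = ⊥
CycleArcs A (x ∷ xs) = ArcsFrom A x x xs

HasDirCycleIn : {V : Set} → (V → V → Set) → (V → Set) → Set
HasDirCycleIn {V} A S =
  Σ (List V) λ c → (2 ≤ length c) × Unique c × All S c × CycleArcs A c

-- Two edge labels in [q, p - q] sum to a number in [2q, 2p - 2q], an interval of fewer than p
-- integers because p < 4q, so such a sum is determined by its residue modulo p. This has two
-- consequences. A vertex on a directed cycle of D_f lies between an in-arc and an out-arc of
-- label q, so as long as its cycle neighbours keep their f-colours it cannot be recoloured: it is
-- frozen. A single recolouring step changes no tree weight except that of the recoloured vertex,
-- unless the root is recoloured, which shifts all other weights by one common amount. Hence along
-- any reconfiguration sequence starting at f the differences of weights between frozen vertices
-- are invariant, so a vertex of X and a vertex outside X, both on cycles of D_f, cannot swap sides.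

module Submission where

open import Defs
open import Data.Empty using (⊥-elim)
open import Data.Fin using (Fin; toℕ; _≟_)
open import Data.Fin.Properties using (toℕ<n; toℕ-injective)
open import Data.List using ([]; _∷_)
open import Data.List.Membership.Propositional using (_∈_)
open import Data.List.Relation.Unary.All using (_∷_)
open import Data.List.Relation.Unary.Any using (here; there; toSum; fromSum)
open import Data.Nat using (ℕ; zero; suc; _+_; _*_; _∸_; _≤_; _<_; s≤s; NonZero; >-nonZero⁻¹; ∣_-_∣; _≤?_)
open import Data.Nat.DivMod using (_%_; _/_; m≡m%n+[m/n]*n; m%n<n; m<n⇒m%n≡m)
open import Data.Nat.Properties hiding (_≟_)
open import Algebra.Properties.CommutativeSemigroup +-commutativeSemigroup
  using (interchange; x∙yz≈y∙xz; xy∙z≈xz∙y; xy∙z≈y∙xz)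
open import Data.Nat.Tactic.RingSolver using (solve-∀)
open import Data.Product using (∃-syntax; ∃₂; _×_; _,_; proj₁; map; map₁; map₂)
open import Data.Sum using (_⊎_; inj₁; inj₂)
import Data.Sum as Sum
open import Function using (_∘_)
open import Level using (0ℓ)
open import Relation.Binary.Bundles using (Setoid)
open import Relation.Binary.Construct.Closure.ReflexiveTransitive using (Star; ε; _◅_)
open import Relation.Binary.PropositionalEquality
  using (_≡_; _≢_; refl; sym; trans; cong; cong₂; subst; ≢-sym; module ≡-Reasoning)
open import Relation.Nullary using (¬_; Dec; yes; no)
open import Relation.Unary using (Pred; _∪_)

+-difference-trans : ∀ {a b c d e f} → a + d ≡ c + b → c + f ≡ e + d → a + f ≡ e + b
+-difference-trans {a} {b} {c} {d} {e} {f} a+d≡c+b c+f≡e+d = +-cancelʳ-≡ d _ _ (begin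
  a + f + d   ≡⟨ xy∙z≈xz∙y a f d ⟩
  a + d + f   ≡⟨ cong (_+ f) a+d≡c+b ⟩
  c + b + f   ≡⟨ xy∙z≈xz∙y c b f ⟩
  c + f + b   ≡⟨ cong (_+ b) c+f≡e+d ⟩
  e + d + b   ≡⟨ xy∙z≈xz∙y e d b ⟩
  e + b + d   ∎)
  where open ≡-Reasoning

+-same-shift : ∀ {a a′ b b′ s s′} → a′ + s ≡ a + s′ → b′ + s ≡ b + s′ → a′ + b ≡ a + b′
+-same-shift {a} {a′} {b} {b′} {s} {s′} e₁ e₂ = +-cancelʳ-≡ s _ _ (begin
  a′ + b + s   ≡⟨ xy∙z≈xz∙y a′ b s ⟩
  a′ + s + b   ≡⟨ cong (_+ b) e₁ ⟩
  a + s′ + b   ≡⟨ +-assoc a s′ b ⟩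
  a + (s′ + b) ≡⟨ cong (a +_) (+-comm s′ b) ⟩
  a + (b + s′) ≡⟨ cong (a +_) e₂ ⟨
  a + (b′ + s) ≡⟨ +-assoc a b′ s ⟨
  a + b′ + s   ∎)
  where open ≡-Reasoning

-- Congruence modulo p

infix 4 _≡_[mod_]

_≡_[mod_] : ℕ → ℕ → ℕ → Set
x ≡ y [mod p ] = ∃₂ λ k l → x + k * p ≡ y + l * p

module _ {p : ℕ} where

  ≡-mod-refl : ∀ {x} → x ≡ x [mod p ]
  ≡-mod-refl = 0 , 0 , refl

  ≡-mod-sym : ∀ {x y} → x ≡ y [mod p ] → y ≡ x [mod p ]
  ≡-mod-sym (k , l , eq) = l , k , sym eq

  ≡-mod-trans : ∀ {x y z} → x ≡ y [mod p ] → y ≡ z [mod p ] → x ≡ z [mod p ]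
  ≡-mod-trans {x} {y} {z} (k , l , eq₁) (k′ , l′ , eq₂) = k + k′ , l′ + l , (begin
    x + (k + k′) * p     ≡⟨ cong (x +_) (*-distribʳ-+ p k k′) ⟩
    x + (k * p + k′ * p) ≡⟨ +-assoc x _ _ ⟨
    x + k * p + k′ * p   ≡⟨ cong (_+ k′ * p) eq₁ ⟩
    y + l * p + k′ * p   ≡⟨ xy∙z≈xz∙y y _ _ ⟩
    y + k′ * p + l * p   ≡⟨ cong (_+ l * p) eq₂ ⟩
    z + l′ * p + l * p   ≡⟨ +-assoc z _ _ ⟩
    z + (l′ * p + l * p) ≡⟨ cong (z +_) (*-distribʳ-+ p l′ l) ⟨
    z + (l′ + l) * p     ∎)
    where open ≡-Reasoning

  +-cong-≡-mod : ∀ {x y u v} → x ≡ y [mod p ] → u ≡ v [mod p ] → x + u ≡ y + v [mod p ]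
  +-cong-≡-mod {x} {y} {u} {v} (k , l , eq₁) (k′ , l′ , eq₂) = k + k′ , l + l′ , (begin
    x + u + (k + k′) * p       ≡⟨ cong (x + u +_) (*-distribʳ-+ p k k′) ⟩
    x + u + (k * p + k′ * p)   ≡⟨ interchange x u _ _ ⟩
    (x + k * p) + (u + k′ * p) ≡⟨ cong₂ _+_ eq₁ eq₂ ⟩
    (y + l * p) + (v + l′ * p) ≡⟨ interchange y v _ _ ⟨
    y + v + (l * p + l′ * p)   ≡⟨ cong (y + v +_) (*-distribʳ-+ p l l′) ⟨
    y + v + (l + l′) * p       ∎)
    where open ≡-Reasoning

  +-cancelʳ-≡-mod : ∀ {x y} a → x + a ≡ y + a [mod p ] → x ≡ y [mod p ]
  +-cancelʳ-≡-mod {x} {y} a (k , l , eq) = k , l , +-cancelʳ-≡ a _ _ (begin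
    x + k * p + a ≡⟨ xy∙z≈xz∙y x _ _ ⟩
    x + a + k * p ≡⟨ eq ⟩
    y + a + l * p ≡⟨ xy∙z≈xz∙y y _ _ ⟩
    y + l * p + a ∎)
    where open ≡-Reasoning

  p+-≡-mod : ∀ x → p + x ≡ x [mod p ]
  p+-≡-mod x = 0 , 1 , trans (+-identityʳ _) (trans (+-comm p x) (cong (x +_) (sym (+-identityʳ p))))

  ≡-mod-window : ∀ {x y} → x ≡ y [mod p ] → x < y + p → y < x + p → x ≡ y
  ≡-mod-window (k , l , eq) = window k l eq
    where
    window : ∀ {x y} k l → x + k * p ≡ y + l * p → x < y + p → y < x + p → x ≡ y
    window {x} {y} zero zero eq _ _ = trans (sym (+-identityʳ x)) (trans eq (+-identityʳ y))
    window {x} {y} (suc k) (suc l) eq = window k l (+-cancelˡ-≡ p _ _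
      (trans (x∙yz≈y∙xz p x _) (trans eq (x∙yz≈y∙xz y p _))))
    window {x} {y} zero (suc l) eq x<y+p _ = ⊥-elim (<⇒≱ x<y+p (begin
      y + p         ≤⟨ +-monoʳ-≤ y (m≤m+n p (l * p)) ⟩
      y + suc l * p ≡⟨ eq ⟨
      x + 0         ≡⟨ +-identityʳ x ⟩
      x             ∎))
      where open ≤-Reasoning
    window (suc k) zero eq x<y+p y<x+p = sym (window zero (suc k) (sym eq) y<x+p x<y+p)

≡-mod-setoid : ℕ → Setoid 0ℓ 0ℓ
≡-mod-setoid p = record
  { Carrier       = ℕ
  ; _≈_           = λ x y → x ≡ y [mod p ]
  ; isEquivalence = record { refl = ≡-mod-refl ; sym = ≡-mod-sym ; trans = ≡-mod-trans }
  }

module ≡-mod-Reasoning (p : ℕ) where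
  open import Relation.Binary.Reasoning.Setoid (≡-mod-setoid p) public

-- Edge labels

module _ (p : ℕ) .{{_ : NonZero p}} where

  diffMod<p : ∀ a b → diffMod p a b < p
  diffMod<p a b = m%n<n _ p

  diffMod-≡-mod : ∀ a b → diffMod p a b + toℕ a ≡ toℕ b [mod p ]
  diffMod-≡-mod a b = m / p , 1 , (begin
    m % p + toℕ a + m / p * p   ≡⟨ xy∙z≈xz∙y (m % p) _ _ ⟩
    m % p + m / p * p + toℕ a   ≡⟨ cong (_+ toℕ a) (m≡m%n+[m/n]*n m p) ⟨
    toℕ b + (p ∸ toℕ a) + toℕ a ≡⟨ +-assoc (toℕ b) _ _ ⟩
    toℕ b + (p ∸ toℕ a + toℕ a) ≡⟨ cong (toℕ b +_) (m∸n+n≡m (<⇒≤ (toℕ<n a))) ⟩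
    toℕ b + p                   ≡⟨ cong (toℕ b +_) (+-identityʳ p) ⟨
    toℕ b + 1 * p               ∎)
    where
    open ≡-Reasoning
    m : ℕ
    m = toℕ b + (p ∸ toℕ a)

  ≡-mod-<-injective : ∀ {x y} → x < p → y < p → x ≡ y [mod p ] → x ≡ y
  ≡-mod-<-injective {x} {y} x<p y<p x≡y =
    ≡-mod-window x≡y (<-≤-trans x<p (m≤n+m p y)) (<-≤-trans y<p (m≤n+m p x))

  toℕ-≡-mod-injective : ∀ {a b : Fin p} → toℕ a ≡ toℕ b [mod p ] → a ≡ b
  toℕ-≡-mod-injective {a} {b} = toℕ-injective ∘ ≡-mod-<-injective (toℕ<n a) (toℕ<n b)

  diffMod-injectiveʳ : ∀ {a b c} → diffMod p a b ≡ diffMod p a c → b ≡ c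
  diffMod-injectiveʳ {a} {b} {c} eq = toℕ-≡-mod-injective (begin
    toℕ b                 ≈⟨ diffMod-≡-mod a b ⟨
    diffMod p a b + toℕ a ≡⟨ cong (_+ toℕ a) eq ⟩
    diffMod p a c + toℕ a ≈⟨ diffMod-≡-mod a c ⟩
    toℕ c                 ∎)
    where open ≡-mod-Reasoning p

  diffMod-self : ∀ a → diffMod p a a ≡ 0
  diffMod-self a = ≡-mod-<-injective (diffMod<p a a) (>-nonZero⁻¹ p)
    (+-cancelʳ-≡-mod (toℕ a) (diffMod-≡-mod a a))

  diffMod-path-≡-mod : ∀ a c b → diffMod p a c + diffMod p c b + toℕ a ≡ toℕ b [mod p ]
  diffMod-path-≡-mod a c b = begin
    diffMod p a c + diffMod p c b + toℕ a   ≡⟨ xy∙z≈y∙xz (diffMod p a c) _ _ ⟩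
    diffMod p c b + (diffMod p a c + toℕ a) ≈⟨ +-cong-≡-mod ≡-mod-refl (diffMod-≡-mod a c) ⟩
    diffMod p c b + toℕ c                   ≈⟨ diffMod-≡-mod c b ⟩
    toℕ b                                   ∎
    where open ≡-mod-Reasoning p

  diffMod-+-≡-mod : ∀ a b c d → diffMod p a b + diffMod p c d + (toℕ a + toℕ c) ≡ toℕ b + toℕ d [mod p ]
  diffMod-+-≡-mod a b c d = begin
    diffMod p a b + diffMod p c d + (toℕ a + toℕ c)   ≡⟨ interchange (diffMod p a b) _ _ _ ⟩
    (diffMod p a b + toℕ a) + (diffMod p c d + toℕ c) ≈⟨ +-cong-≡-mod (diffMod-≡-mod a b) (diffMod-≡-mod c d) ⟩
    toℕ b + toℕ d                                     ∎
    where open ≡-mod-Reasoning p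

  diffMod-∣-∣ : ∀ a b → diffMod p a b ≡ ∣ toℕ a - toℕ b ∣ ⊎ diffMod p a b + ∣ toℕ a - toℕ b ∣ ≡ p
  diffMod-∣-∣ a b with toℕ a ≤? toℕ b
  ... | yes a≤b = inj₁ (trans
    (≡-mod-<-injective (diffMod<p a b) (≤-<-trans (m∸n≤m (toℕ b) (toℕ a)) (toℕ<n b))
      (+-cancelʳ-≡-mod (toℕ a) (begin
        diffMod p a b + toℕ a ≈⟨ diffMod-≡-mod a b ⟩
        toℕ b                 ≡⟨ m∸n+n≡m a≤b ⟨
        toℕ b ∸ toℕ a + toℕ a ∎)))
    (sym (m≤n⇒∣m-n∣≡n∸m a≤b)))
    where open ≡-mod-Reasoning p
  ... | no a≰b = inj₂ (trans (cong (diffMod p a b +_) (m≤n⇒∣n-m∣≡n∸m (<⇒≤ b<a)))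
    (≡-mod-window (+-cancelʳ-≡-mod (toℕ b) sum≡p) upper lower))
    where
    b<a : toℕ b < toℕ a
    b<a = ≰⇒> a≰b
    d : ℕ
    d = toℕ a ∸ toℕ b
    sum≡p : diffMod p a b + d + toℕ b ≡ p + toℕ b [mod p ]
    sum≡p = begin
      diffMod p a b + d + toℕ b   ≡⟨ +-assoc (diffMod p a b) d _ ⟩
      diffMod p a b + (d + toℕ b) ≡⟨ cong (diffMod p a b +_) (m∸n+n≡m (<⇒≤ b<a)) ⟩
      diffMod p a b + toℕ a       ≈⟨ diffMod-≡-mod a b ⟩
      toℕ b                       ≈⟨ p+-≡-mod (toℕ b) ⟨
      p + toℕ b                   ∎
      where open ≡-mod-Reasoning p
    upper : diffMod p a b + d < p + p
    upper = +-mono-< (diffMod<p a b) (≤-<-trans (m∸n≤m (toℕ a) (toℕ b)) (toℕ<n a))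
    lower : p < diffMod p a b + d + p
    lower = +-monoˡ-< p (<-≤-trans (m<n⇒0<n∸m b<a) (m≤n+m d (diffMod p a b)))

  diffMod-antisym : ∀ {a b} → a ≢ b → diffMod p a b + diffMod p b a ≡ p
  diffMod-antisym {a} {b} a≢b = ≡-mod-window (+-cancelʳ-≡-mod (toℕ a + toℕ b) sum≡p) upper lower
    where
    sum≡p : diffMod p a b + diffMod p b a + (toℕ a + toℕ b) ≡ p + (toℕ a + toℕ b) [mod p ]
    sum≡p = begin
      diffMod p a b + diffMod p b a + (toℕ a + toℕ b) ≈⟨ diffMod-+-≡-mod a b b a ⟩
      toℕ b + toℕ a                                   ≡⟨ +-comm (toℕ b) (toℕ a) ⟩
      toℕ a + toℕ b                                   ≈⟨ p+-≡-mod _ ⟨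
      p + (toℕ a + toℕ b)                             ∎
      where open ≡-mod-Reasoning p
    upper : diffMod p a b + diffMod p b a < p + p
    upper = +-mono-< (diffMod<p a b) (diffMod<p b a)
    diffMod≢0 : diffMod p a b ≢ 0
    diffMod≢0 eq = a≢b (diffMod-injectiveʳ {a} (trans (diffMod-self a) (sym eq)))
    lower : p < diffMod p a b + diffMod p b a + p
    lower = +-monoˡ-< p (<-≤-trans (n≢0⇒n>0 diffMod≢0) (m≤m+n _ _))

-- Labels in [q, p - q]

InRange : ℕ → ℕ → ℕ → Set
InRange p q x = q ≤ x × x ≤ p ∸ q

inRange-complement : ∀ {p q x d} → q ≤ p → x + d ≡ p → InRange p q d → InRange p q x
inRange-complement {p} {q} {x} {d} q≤p x+d≡p (q≤d , d≤p∸q) =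
  subst (InRange p q) (sym x≡p∸d)
    (subst (_≤ p ∸ d) (m∸[m∸n]≡n q≤p) (∸-monoʳ-≤ p d≤p∸q) , ∸-monoʳ-≤ p q≤d)
  where
  x≡p∸d : x ≡ p ∸ d
  x≡p∸d = trans (sym (m+n∸n≡m x d)) (cong (_∸ d) x+d≡p)

module Rigidity {p q : ℕ} .{{_ : NonZero p}} (2q≤p : 2 * q ≤ p) (p<4q : p < 4 * q) where

  q+q≤p : q + q ≤ p
  q+q≤p = subst (_≤ p) (cong (q +_) (+-identityʳ q)) 2q≤p

  q≤p : q ≤ p
  q≤p = m+n≤o⇒m≤o q q+q≤p

  q-inRange : InRange p q q
  q-inRange = ≤-refl , m+n≤o⇒m≤o∸n q q+q≤p

  diffMod-inRange : ∀ {a b} → InRange p q ∣ toℕ a - toℕ b ∣ → InRange p q (diffMod p a b)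
  diffMod-inRange {a} {b} r with diffMod-∣-∣ p a b
  ... | inj₁ eq = subst (InRange p q) (sym eq) r
  ... | inj₂ eq = inRange-complement q≤p eq r

  inRange-sum-rigid : ∀ {x y u v} → InRange p q x → InRange p q y → InRange p q u → InRange p q v →
                      x + y ≡ u + v [mod p ] → x + y ≡ u + v
  inRange-sum-rigid rx ry ru rv eq = ≡-mod-window eq (below rx ry ru rv) (below ru rv rx ry)
    where
    width : (p ∸ q) + (p ∸ q) < (q + q) + p
    width = +-cancelʳ-< (q + q) _ _ (begin-strict
      (p ∸ q) + (p ∸ q) + (q + q) ≡⟨ interchange (p ∸ q) _ q q ⟩
      (p ∸ q + q) + (p ∸ q + q)   ≡⟨ cong₂ _+_ (m∸n+n≡m q≤p) (m∸n+n≡m q≤p) ⟩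
      p + p                       <⟨ +-monoʳ-< p p<4q ⟩
      p + 4 * q                   ≡⟨ regroup p q ⟩
      q + q + p + (q + q)         ∎)
      where
      open ≤-Reasoning
      regroup : ∀ a b → a + 4 * b ≡ b + b + a + (b + b)
      regroup = solve-∀
    below : ∀ {x y u v} → InRange p q x → InRange p q y → InRange p q u → InRange p q v →
            x + y < u + v + p
    below (_ , x≤) (_ , y≤) (q≤u , _) (q≤v , _) =
      <-≤-trans (≤-<-trans (+-mono-≤ x≤ y≤) width) (+-monoˡ-≤ p (+-mono-≤ q≤u q≤v))

  diffMod-path-rigid : ∀ {a b c c′} →
    InRange p q (diffMod p a c) → InRange p q (diffMod p c b) →
    InRange p q (diffMod p a c′) → InRange p q (diffMod p c′ b) →
    diffMod p a c + diffMod p c b ≡ diffMod p a c′ + diffMod p c′ b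
  diffMod-path-rigid {a} {b} {c} {c′} r₁ r₂ r₃ r₄ = inRange-sum-rigid r₁ r₂ r₃ r₄
    (+-cancelʳ-≡-mod (toℕ a) (≡-mod-trans (diffMod-path-≡-mod p a c b)
                                          (≡-mod-sym (diffMod-path-≡-mod p a c′ b))))

  diffMod-cross-rigid : ∀ {c c′ x b} →
    InRange p q (diffMod p c′ x) → InRange p q (diffMod p c b) →
    InRange p q (diffMod p c x) → InRange p q (diffMod p c′ b) →
    diffMod p c′ x + diffMod p c b ≡ diffMod p c x + diffMod p c′ b
  diffMod-cross-rigid {c} {c′} {x} {b} r₁ r₂ r₃ r₄ = inRange-sum-rigid r₁ r₂ r₃ r₄
    (+-cancelʳ-≡-mod (toℕ c′ + toℕ c) (begin
      diffMod p c′ x + diffMod p c b + (toℕ c′ + toℕ c) ≈⟨ diffMod-+-≡-mod p c′ x c b ⟩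
      toℕ x + toℕ b                                     ≈⟨ diffMod-+-≡-mod p c x c′ b ⟨
      diffMod p c x + diffMod p c′ b + (toℕ c + toℕ c′)
        ≡⟨ cong (diffMod p c x + diffMod p c′ b +_) (+-comm (toℕ c) (toℕ c′)) ⟩
      diffMod p c x + diffMod p c′ b + (toℕ c′ + toℕ c) ∎))
    where open ≡-mod-Reasoning p

  diffMod-q-midpoint-unique : ∀ {a b c c′} → diffMod p a c ≡ q → diffMod p c b ≡ q →
    InRange p q (diffMod p a c′) → InRange p q (diffMod p c′ b) → c′ ≡ c
  diffMod-q-midpoint-unique {a} {b} {c} {c′} ac≡q cb≡q r₁@(q≤ac′ , _) r₂@(q≤c′b , _) =
    diffMod-injectiveʳ p {a} (trans ac′≡q (sym ac≡q))
    where
    sum≡q+q : diffMod p a c′ + diffMod p c′ b ≡ q + q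
    sum≡q+q = trans (sym (diffMod-path-rigid {a} {b} {c} {c′} (subst (InRange p q) (sym ac≡q) q-inRange)
                                             (subst (InRange p q) (sym cb≡q) q-inRange) r₁ r₂))
                    (cong₂ _+_ ac≡q cb≡q)
    ac′≡q : diffMod p a c′ ≡ q
    ac′≡q = ≤-antisym (+-cancelˡ-≤ q _ _ (begin
      q + diffMod p a c′              ≤⟨ +-monoˡ-≤ (diffMod p a c′) q≤c′b ⟩
      diffMod p c′ b + diffMod p a c′ ≡⟨ +-comm (diffMod p c′ b) _ ⟩
      diffMod p a c′ + diffMod p c′ b ≡⟨ sum≡q+q ⟩
      q + q                           ∎)) q≤ac′
      where open ≤-Reasoning

-- Vertices on directed cycles

HasInAndOutNeighbours : {V : Set} → (V → V → Set) → Pred V 0ℓ → Set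
HasInAndOutNeighbours A S = ∀ {z} → S z → (∃[ a ] S a × A a z) × (∃[ b ] S b × A z b)

module _ {V : Set} {A : V → V → Set} where

  arcsFrom-in : ∀ {h x ys z} → ArcsFrom A h x ys → z ≡ h ⊎ z ∈ ys → ∃[ a ] a ∈ x ∷ ys × A a z
  arcsFrom-in {ys = []}    arc        (inj₁ refl)         = _ , here refl , arc
  arcsFrom-in {ys = _ ∷ _} (arc , _)  (inj₂ (here refl))  = _ , here refl , arc
  arcsFrom-in {ys = _ ∷ _} (_ , arcs) (inj₂ (there z∈ys)) = map₂ (map₁ there) (arcsFrom-in arcs (inj₂ z∈ys))
  arcsFrom-in {ys = _ ∷ _} (_ , arcs) (inj₁ z≡h)          = map₂ (map₁ there) (arcsFrom-in arcs (inj₁ z≡h))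

  arcsFrom-out : ∀ {h x ys z} → ArcsFrom A h x ys → z ∈ x ∷ ys → ∃[ b ] (b ≡ h ⊎ b ∈ ys) × A z b
  arcsFrom-out {ys = []}    arc        (here refl)  = _ , inj₁ refl , arc
  arcsFrom-out {ys = _ ∷ _} (arc , _)  (here refl)  = _ , inj₂ (here refl) , arc
  arcsFrom-out {ys = _ ∷ _} (_ , arcs) (there z∈ys) = map₂ (map₁ (Sum.map₂ there)) (arcsFrom-out arcs z∈ys)

  cycle-hasInAndOutNeighbours : ∀ {c} → CycleArcs A c → HasInAndOutNeighbours A (_∈ c)
  cycle-hasInAndOutNeighbours {_ ∷ _} arcs z∈c =
    arcsFrom-in arcs (toSum z∈c) , map₂ (map₁ fromSum) (arcsFrom-out arcs z∈c)

  hasInAndOutNeighbours-∪ : ∀ {S S′} → HasInAndOutNeighbours A S → HasInAndOutNeighbours A S′ →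
                            HasInAndOutNeighbours A (S ∪ S′)
  hasInAndOutNeighbours-∪ nbrs nbrs′ (inj₁ z∈S)  = map (map₂ (map₁ inj₁)) (map₂ (map₁ inj₁)) (nbrs z∈S)
  hasInAndOutNeighbours-∪ nbrs nbrs′ (inj₂ z∈S′) = map (map₂ (map₁ inj₂)) (map₂ (map₁ inj₂)) (nbrs′ z∈S′)

  cycle-member : ∀ {S : Pred V 0ℓ} → HasDirCycleIn A S → ∃[ c ] CycleArcs A c × ∃[ x ] x ∈ c × S x
  cycle-member (x ∷ c , _ , _ , Sx ∷ _ , arcs) = x ∷ c , arcs , x , here refl , Sx

-- Weights along the spanning tree

AgreesOn : {A B : Set} → Pred A 0ℓ → (A → B) → (A → B) → Set
AgreesOn S f h = ∀ {z} → S z → h z ≡ f z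

module _ {n : ℕ} {E : Edges n} (T : RootedSpanningTree E) where
  open RootedSpanningTree T

  tree-ind : ∀ {ℓ} (P : Pred (Fin n) ℓ) → P root → (∀ v → v ≢ root → P (parent v) → P v) → ∀ v → P v
  tree-ind P base step v = go (suc (depth v)) v ≤-refl
    where
    go : ∀ k v → depth v < k → P v
    go (suc k) v (s≤s depth-v≤k) with v ≟ root
    ... | yes refl    = base
    ... | no v≢root = step v v≢root (go k (parent v) (<-≤-trans (depth-dec v v≢root) depth-v≤k))

  parent-≢ : ∀ {v} → v ≢ root → parent v ≢ v
  parent-≢ {v} v≢root pv≡v = <-irrefl (cong depth pv≡v) (depth-dec v v≢root)

  child-of-root : ∀ {v} → v ≢ root → ∃[ x ] x ≢ root × parent x ≡ root
  child-of-root {v} = tree-ind (λ v → v ≢ root → ∃[ x ] x ≢ root × parent x ≡ root)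
                               (λ root≢root → ⊥-elim (root≢root refl)) step v
    where
    step : ∀ v → v ≢ root → (parent v ≢ root → ∃[ x ] x ≢ root × parent x ≡ root) →
           v ≢ root → ∃[ x ] x ≢ root × parent x ≡ root
    step v v≢root ih _ with parent v ≟ root
    ... | yes pv≡root = v , v≢root , pv≡root
    ... | no pv≢root  = ih pv≢root

  module _ (p : ℕ) .{{_ : NonZero p}} where

    wtFuel-root : ∀ h k → wtFuel T p h k root ≡ 0
    wtFuel-root h zero = refl
    wtFuel-root h (suc k) with root ≟ root
    ... | yes _         = refl
    ... | no root≢root = ⊥-elim (root≢root refl)

    wt-root : ∀ h → wt T p h root ≡ 0
    wt-root h = wtFuel-root h _

    wtFuel-stable : ∀ h {k k′ v} → depth v < k → depth v < k′ → wtFuel T p h k v ≡ wtFuel T p h k′ v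
    wtFuel-stable h {suc k} {suc k′} {v} (s≤s dv≤k) (s≤s dv≤k′) with v ≟ root
    ... | yes _     = refl
    ... | no v≢root = cong (_+ _) (wtFuel-stable h (<-≤-trans (depth-dec v v≢root) dv≤k)
                                                   (<-≤-trans (depth-dec v v≢root) dv≤k′))

    wtFuel-cong : ∀ {h h′} → (∀ x → h x ≡ h′ x) → ∀ k v → wtFuel T p h k v ≡ wtFuel T p h′ k v
    wtFuel-cong h≗h′ zero    v = refl
    wtFuel-cong {h} {h′} h≗h′ (suc k) v with v ≟ root
    ... | yes _     = refl
    ... | no v≢root = cong₂ _+_ (wtFuel-cong h≗h′ k (parent v)) (contrib-cong (parent-edge v v≢root))
      where
      contrib-cong : ∀ tag → contrib T p h v tag ≡ contrib T p h′ v tag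
      contrib-cong (inj₁ _) = cong₂ (diffMod p) (h≗h′ (parent v)) (h≗h′ v)
      contrib-cong (inj₂ _) = cong (p ∸_) (cong₂ (diffMod p) (h≗h′ v) (h≗h′ (parent v)))

    wt-cong : ∀ {h h′} → (∀ x → h x ≡ h′ x) → ∀ v → wt T p h v ≡ wt T p h′ v
    wt-cong h≗h′ v = wtFuel-cong h≗h′ _ v

  module _ {p q : ℕ} .{{_ : NonZero p}} (0<q : 0 < q) (2q≤p : 2 * q ≤ p) (p<4q : p < 4 * q) where
    open Rigidity {p} {q} 2q≤p p<4q

    label-inRange : ∀ {h} → IsPQColouring p q E h → ∀ {x y} → Adj E x y → InRange p q (diffMod p (h x) (h y))
    label-inRange {h} ok {x} {y} (inj₁ xy∈E) = diffMod-inRange {h x} {h y} (ok x y xy∈E)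
    label-inRange {h} ok {x} {y} (inj₂ yx∈E) =
      diffMod-inRange {h x} {h y} (subst (InRange p q) (∣-∣-comm (toℕ (h y)) _) (ok y x yx∈E))

    adjacent-colours-≢ : ∀ {h} → IsPQColouring p q E h → ∀ {x y} → (x , y) ∈ E → h x ≢ h y
    adjacent-colours-≢ ok {x} {y} xy∈E hx≡hy =
      <⇒≱ 0<q (subst (q ≤_) (m≡n⇒∣m-n∣≡0 (cong toℕ hx≡hy)) (proj₁ (ok x y xy∈E)))

    -- A backward tree edge contributes p - φ(v, parent v), the forward label, as adjacent colours differ.
    contrib-diffMod : ∀ {h} → IsPQColouring p q E h → ∀ v tag →
                      contrib T p h v tag ≡ diffMod p (h (parent v)) (h v)
    contrib-diffMod     ok v (inj₁ _)      = refl
    contrib-diffMod {h} ok v (inj₂ v-pv∈E) = trans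
      (cong (_∸ diffMod p (h v) (h (parent v)))
            (sym (diffMod-antisym p (≢-sym (adjacent-colours-≢ {h} ok v-pv∈E)))))
      (m+n∸n≡m (diffMod p (h (parent v)) (h v)) (diffMod p (h v) (h (parent v))))

    wt-parent : ∀ {h} → IsPQColouring p q E h → ∀ {v} → v ≢ root →
                wt T p h v ≡ wt T p h (parent v) + diffMod p (h (parent v)) (h v)
    wt-parent {h} ok {v} v≢root with v ≟ root
    ... | yes v≡root = ⊥-elim (v≢root v≡root)
    ... | no v≢root′ = cong₂ _+_ (wtFuel-stable p h (depth-dec v v≢root′) ≤-refl)
                                 (contrib-diffMod {h} ok v (parent-edge v v≢root′))

    wt-child-of-root : ∀ {h} → IsPQColouring p q E h → ∀ {v} → v ≢ root → parent v ≡ root →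
                       wt T p h v ≡ diffMod p (h root) (h v)
    wt-child-of-root {h} ok {v} v≢root pv≡root = trans (wt-parent {h} ok v≢root)
      (trans (cong (λ u → wt T p h u + diffMod p (h u) (h v)) pv≡root) (cong (_+ _) (wt-root p h)))

    module NonRootRecolouring {h h′ : Fin n → Fin p} (ok : IsPQColouring p q E h) (ok′ : IsPQColouring p q E h′)
                              {w : Fin n} (same : ∀ x → x ≢ w → h x ≡ h′ x) (w≢root : w ≢ root) where

      inRange : ∀ {x y} → Adj E x y → InRange p q (diffMod p (h x) (h y))
      inRange = label-inRange {h} ok

      inRange′ : ∀ {x y} → Adj E x y → InRange p q (diffMod p (h′ x) (h′ y))
      inRange′ = label-inRange {h′} ok′

      -- wt h u + diffMod p (h u) b is the weight of the tree path to u extended by an edge to colour b.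
      ExtendedWeightKept : Fin n → Set
      ExtendedWeightKept u = ∀ b → InRange p q (diffMod p (h u) b) → InRange p q (diffMod p (h′ u) b) →
                             wt T p h′ u + diffMod p (h′ u) b ≡ wt T p h u + diffMod p (h u) b

      parent-label-inRange : ∀ {v} → v ≢ root → InRange p q (diffMod p (h (parent v)) (h′ v))
      parent-label-inRange {v} v≢root with v ≟ w
      ... | yes refl = subst (λ c → InRange p q (diffMod p c (h′ v)))
                             (sym (same (parent v) (parent-≢ v≢root))) (inRange′ (parent-edge v v≢root))
      ... | no v≢w   = subst (λ c → InRange p q (diffMod p (h (parent v)) c))
                             (same v v≢w) (inRange (parent-edge v v≢root))

      wt′-via-parent : ∀ {v} → v ≢ root → ExtendedWeightKept (parent v) →
                       wt T p h′ v ≡ wt T p h (parent v) + diffMod p (h (parent v)) (h′ v)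
      wt′-via-parent {v} v≢root kept = trans (wt-parent {h′} ok′ v≢root)
        (kept (h′ v) (parent-label-inRange v≢root) (inRange′ (parent-edge v v≢root)))

      extendedWeight-kept : ∀ u → ExtendedWeightKept u
      extendedWeight-kept = tree-ind ExtendedWeightKept base step
        where
        base : ExtendedWeightKept root
        base b _ _ = cong₂ _+_ (trans (wt-root p h′) (sym (wt-root p h)))
                               (cong (λ c → diffMod p c b) (sym (same root (≢-sym w≢root))))
        step : ∀ v → v ≢ root → ExtendedWeightKept (parent v) → ExtendedWeightKept v
        step v v≢root kept b r r′ = begin
          wt T p h′ v + diffMod p (h′ v) b                           ≡⟨ cong (_+ _) (wt′-via-parent v≢root kept) ⟩
          wt T p h u + diffMod p (h u) (h′ v) + diffMod p (h′ v) b   ≡⟨ +-assoc (wt T p h u) _ _ ⟩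
          wt T p h u + (diffMod p (h u) (h′ v) + diffMod p (h′ v) b) ≡⟨ cong (wt T p h u +_) path ⟨
          wt T p h u + (diffMod p (h u) (h v) + diffMod p (h v) b)   ≡⟨ +-assoc (wt T p h u) _ _ ⟨
          wt T p h u + diffMod p (h u) (h v) + diffMod p (h v) b     ≡⟨ cong (_+ _) (wt-parent {h} ok v≢root) ⟨
          wt T p h v + diffMod p (h v) b                             ∎
          where
          open ≡-Reasoning
          u : Fin n
          u = parent v
          path : diffMod p (h u) (h v) + diffMod p (h v) b ≡ diffMod p (h u) (h′ v) + diffMod p (h′ v) b
          path = diffMod-path-rigid {h u} {b} {h v} {h′ v}
                   (inRange (parent-edge v v≢root)) r (parent-label-inRange v≢root) r′

      wt-recolour-nonroot : ∀ {v} → v ≢ w → wt T p h′ v ≡ wt T p h v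
      wt-recolour-nonroot {v} v≢w = byRoot (v ≟ root)
        where
        open ≡-Reasoning
        byRoot : Dec (v ≡ root) → wt T p h′ v ≡ wt T p h v
        byRoot (yes refl)  = trans (wt-root p h′) (sym (wt-root p h))
        byRoot (no v≢root) = begin
          wt T p h′ v                 ≡⟨ wt′-via-parent v≢root (extendedWeight-kept u) ⟩
          wt T p h u + diffMod p (h u) (h′ v) ≡⟨ cong (λ c → wt T p h u + diffMod p (h u) c) (same v v≢w) ⟨
          wt T p h u + diffMod p (h u) (h v)  ≡⟨ wt-parent {h} ok v≢root ⟨
          wt T p h v                  ∎
          where
          u : Fin n
          u = parent v

    module RootRecolouring {h h′ : Fin n → Fin p} (ok : IsPQColouring p q E h) (ok′ : IsPQColouring p q E h′)
                           (same : ∀ x → x ≢ root → h x ≡ h′ x) {b : Fin p}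
                           (r : InRange p q (diffMod p (h root) b)) (r′ : InRange p q (diffMod p (h′ root) b)) where

      β β′ : ℕ
      β  = diffMod p (h root) b
      β′ = diffMod p (h′ root) b

      Shifted : Pred (Fin n) 0ℓ
      Shifted v = wt T p h′ v + β ≡ wt T p h v + β′

      child-of-root-shifted : ∀ {v} → v ≢ root → parent v ≡ root → Shifted v
      child-of-root-shifted {v} v≢root pv≡root = begin
        wt T p h′ v + β                ≡⟨ cong (_+ β) (wt-child-of-root {h′} ok′ v≢root pv≡root) ⟩
        diffMod p (h′ root) (h′ v) + β ≡⟨ cong (λ c → diffMod p (h′ root) c + β) (same v v≢root) ⟨
        diffMod p (h′ root) (h v) + β  ≡⟨ diffMod-cross-rigid {h root} {h′ root} {h v} {b} r₁ r r₂ r′ ⟩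
        diffMod p (h root) (h v) + β′  ≡⟨ cong (_+ β′) (wt-child-of-root {h} ok v≢root pv≡root) ⟨
        wt T p h v + β′                ∎
        where
        open ≡-Reasoning
        edge : Adj E root v
        edge = subst (λ u → Adj E u v) pv≡root (parent-edge v v≢root)
        r₁ : InRange p q (diffMod p (h′ root) (h v))
        r₁ = subst (λ c → InRange p q (diffMod p (h′ root) c)) (sym (same v v≢root)) (label-inRange {h′} ok′ edge)
        r₂ : InRange p q (diffMod p (h root) (h v))
        r₂ = label-inRange {h} ok edge

      shifted-from-parent : ∀ {v} → v ≢ root → parent v ≢ root → Shifted (parent v) → Shifted v
      shifted-from-parent {v} v≢root pv≢root shifted = begin
        wt T p h′ v + β                           ≡⟨ cong (_+ β) (wt-parent {h′} ok′ v≢root) ⟩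
        wt T p h′ u + diffMod p (h′ u) (h′ v) + β ≡⟨ cong₂ (λ c d → wt T p h′ u + diffMod p c d + β)
                                                           (same u pv≢root) (same v v≢root) ⟨
        wt T p h′ u + ℓ + β                       ≡⟨ xy∙z≈xz∙y (wt T p h′ u) ℓ β ⟩
        wt T p h′ u + β + ℓ                       ≡⟨ cong (_+ ℓ) shifted ⟩
        wt T p h u + β′ + ℓ                       ≡⟨ xy∙z≈xz∙y (wt T p h u) β′ ℓ ⟩
        wt T p h u + ℓ + β′                       ≡⟨ cong (_+ β′) (wt-parent {h} ok v≢root) ⟨
        wt T p h v + β′                           ∎
        where
        open ≡-Reasoning
        u : Fin n
        u = parent v
        ℓ : ℕ
        ℓ = diffMod p (h u) (h v)

      wt-shift : ∀ {v} → v ≢ root → Shifted v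
      wt-shift {v} = tree-ind (λ v → v ≢ root → Shifted v) (λ root≢root → ⊥-elim (root≢root refl)) step v
        where
        step : ∀ v → v ≢ root → (parent v ≢ root → Shifted (parent v)) → v ≢ root → Shifted v
        step v v≢root ih _ = byParent (parent v ≟ root)
          where
          byParent : Dec (parent v ≡ root) → Shifted v
          byParent (yes pv≡root) = child-of-root-shifted v≢root pv≡root
          byParent (no pv≢root)  = shifted-from-parent v≢root pv≢root (ih pv≢root)

    wt-difference-recolour : ∀ {h h′} → IsPQColouring p q E h → IsPQColouring p q E h′ →
      ∀ {w} → (∀ x → x ≢ w → h x ≡ h′ x) → ∀ {x y} → x ≢ w → y ≢ w →
      wt T p h′ x + wt T p h y ≡ wt T p h x + wt T p h′ y
    wt-difference-recolour ok ok′ {w} same x≢w y≢w with w ≟ root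
    ... | no w≢root = cong₂ _+_ (wt-recolour-nonroot x≢w) (sym (wt-recolour-nonroot y≢w))
      where open NonRootRecolouring ok ok′ same w≢root
    wt-difference-recolour {h} {h′} ok ok′ same {x} {y} x≢w y≢w | yes refl with child-of-root x≢w
    ... | c , c≢root , pc≡root = +-same-shift {wt T p h x} {wt T p h′ x} {wt T p h y} {wt T p h′ y}
                                   (wt-shift x≢w) (wt-shift y≢w)
      where
      edge : Adj E root c
      edge = subst (λ u → Adj E u c) pc≡root (parent-edge c c≢root)
      r : InRange p q (diffMod p (h root) (h c))
      r = label-inRange {h} ok edge
      r′ : InRange p q (diffMod p (h′ root) (h c))
      r′ = subst (λ d → InRange p q (diffMod p (h′ root) d)) (sym (same c c≢root)) (label-inRange {h′} ok′ edge)
      open RootRecolouring ok ok′ same r r′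

    wt-difference-step : ∀ {H H′ : PQColouring p q E} → Step H H′ → ∀ {x y} →
      proj₁ H x ≡ proj₁ H′ x → proj₁ H y ≡ proj₁ H′ y →
      wt T p (proj₁ H′) x + wt T p (proj₁ H) y ≡ wt T p (proj₁ H) x + wt T p (proj₁ H′) y
    wt-difference-step {h , ok} {h′ , ok′} (w , same) {x} {y} hx≡h′x hy≡h′y with h w ≟ h′ w
    ... | yes hw≡h′w = cong₂ _+_ (sym (wt-cong p h≗h′ x)) (wt-cong p h≗h′ y)
      where
      h≗h′ : ∀ z → h z ≡ h′ z
      h≗h′ z with z ≟ w
      ... | yes refl = hw≡h′w
      ... | no z≢w   = same z z≢w
    ... | no hw≢h′w = wt-difference-recolour ok ok′ same (moved-≢ hx≡h′x) (moved-≢ hy≡h′y)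
      where
      moved-≢ : ∀ {z} → h z ≡ h′ z → z ≢ w
      moved-≢ hz≡h′z refl = hw≢h′w hz≡h′z

    q<p : q < p
    q<p = <-≤-trans (m<m+n q 0<q) q+q≤p

    dArc-diffMod : ∀ {f x y} → DArc p q E f x y → diffMod p (f x) (f y) ≡ q
    dArc-diffMod (_ , label≡q%p) = trans label≡q%p (m<n⇒m%n≡m q<p)

    dArc-irreflexive : ∀ {f x} → ¬ DArc p q E f x x
    dArc-irreflexive {f} {x} arc = <⇒≢ 0<q (trans (sym (diffMod-self p (f x))) (dArc-diffMod {f} arc))

    agreesOn-step : ∀ {f S} → HasInAndOutNeighbours (DArc p q E f) S → ∀ {H H′ : PQColouring p q E} →
                    Step H H′ → AgreesOn S f (proj₁ H) → AgreesOn S f (proj₁ H′)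
    agreesOn-step {f} {S} nbrs {h , _} {h′ , ok′} (w , same) agree {z} z∈S with z ≟ w
    ... | no z≢w = trans (sym (same z z≢w)) (agree z∈S)
    ... | yes refl with nbrs z∈S
    ... | (a , a∈S , a→z) , (b , b∈S , z→b) =
      diffMod-q-midpoint-unique {f a} {f b} (dArc-diffMod {f} a→z) (dArc-diffMod {f} z→b)
      (subst (λ c → InRange p q (diffMod p c (h′ z))) (kept a∈S a≢z) (label-inRange {h′} ok′ (proj₁ a→z)))
      (subst (λ c → InRange p q (diffMod p (h′ z) c)) (kept b∈S b≢z) (label-inRange {h′} ok′ (proj₁ z→b)))
      where
      kept : ∀ {x} → S x → x ≢ z → h′ x ≡ f x
      kept x∈S x≢z = trans (sym (same _ x≢z)) (agree x∈S)
      a≢z : a ≢ z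
      a≢z refl = dArc-irreflexive {f} a→z
      b≢z : b ≢ z
      b≢z refl = dArc-irreflexive {f} z→b

    wt-difference-star : ∀ {f S} → HasInAndOutNeighbours (DArc p q E f) S → ∀ {H H′ : PQColouring p q E} →
      Star Step H H′ → AgreesOn S f (proj₁ H) → ∀ {x y} → S x → S y →
      wt T p (proj₁ H′) x + wt T p (proj₁ H) y ≡ wt T p (proj₁ H) x + wt T p (proj₁ H′) y
    wt-difference-star nbrs ε agree _ _ = refl
    wt-difference-star {f} {S} nbrs {H} {H′} (_◅_ {j = J} s ss) agree {x} {y} x∈S y∈S =
      +-difference-trans {W H′ x} {W H′ y} {W J x} {W J y} {W H x} {W H y}
        (wt-difference-star nbrs ss agree′ x∈S y∈S) (wt-difference-step {H} {J} s (unchanged x∈S) (unchanged y∈S))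
      where
      W : PQColouring p q E → Fin n → ℕ
      W K = wt T p (proj₁ K)
      agree′ : AgreesOn S f (proj₁ J)
      agree′ = agreesOn-step nbrs {H} {J} s agree
      unchanged : ∀ {z} → S z → proj₁ H z ≡ proj₁ J z
      unchanged z∈S = trans (agree z∈S) (sym (agree′ z∈S))

lemma2p9 : (p q : ℕ) → .{{_ : NonZero p}} → .{{_ : NonZero q}} →
           2 * q ≤ p → p < 4 * q →
           (n : ℕ) (E : Edges n) → IsOriented E →
           (f g : PQColouring p q E) →
           (T : RootedSpanningTree E) →
           let X : Fin n → Set
               X v = wt T p (proj₁ f) v ≤ wt T p (proj₁ g) v
           in HasDirCycleIn (DArc p q E (proj₁ f)) X →
              HasDirCycleIn (DArc p q E (proj₁ f)) (λ v → ¬ X v) →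
              ¬ Reconfigures f g
lemma2p9 p q 2q≤p p<4q n E _ F G T cycle₁ cycle₂ F↝G
  with cycle-member cycle₁ | cycle-member cycle₂
... | c₁ , arcs₁ , x₁ , x₁∈c₁ , x₁∈X | c₂ , arcs₂ , x₂ , x₂∈c₂ , x₂∉X =
  x₂∉X (+-cancelʳ-≤ (wt T p f x₁) _ _ (begin
    wt T p f x₂ + wt T p f x₁ ≤⟨ +-monoʳ-≤ (wt T p f x₂) x₁∈X ⟩
    wt T p f x₂ + wt T p g x₁ ≡⟨ difference ⟨
    wt T p g x₂ + wt T p f x₁ ∎))
  where
  open ≤-Reasoning
  f g : Fin n → Fin p
  f = proj₁ F
  g = proj₁ G
  frozen : HasInAndOutNeighbours (DArc p q E f) ((_∈ c₁) ∪ (_∈ c₂))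
  frozen = hasInAndOutNeighbours-∪ (cycle-hasInAndOutNeighbours arcs₁) (cycle-hasInAndOutNeighbours arcs₂)
  difference : wt T p g x₂ + wt T p f x₁ ≡ wt T p f x₂ + wt T p g x₁
  difference = wt-difference-star T (>-nonZero⁻¹ q) 2q≤p p<4q frozen F↝G (λ _ → refl) (inj₂ x₂∈c₂) (inj₁ x₁∈c₁)
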